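{- Let $p$ be an even integer greater than $2$, let $k \geq 1$ be an integer, and let $D$ be an oriented graph of order $n\geq p+2$. Then $\mathrm{inv}^{= p}(D) \leq 2\,\mathrm{fas}(D) + 2pn$.
   Context: For an oriented graph $D$ and $X\subseteq V(D)$, the inversion of $X$ reverses the orientation of every arc with both endpoints in $X$. A $(=p)$-inversion is the inversion of a set of exactly $p$ vertices. $\mathrm{inv}^{=p}(D)$ is the minimum number of $(=p)$-inversions whose successive application makes $D$ acyclic ($+\infty$ if impossible). $\mathrm{fas}(D)$ is the minimum size of a set of arcs whose deletion makes $D$ acyclic. -}

module Defs where

open import Data.Nat using (ℕ)
open import Data.Bool using (Bool; true; false; _∧_; not; if_then_else_)
open import Data.Fin using (Fin)
open import Data.Fin.Subset using (Subset; ∣_∣)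
open import Data.Vec using (lookup)
open import Data.List using (List; foldl)
open import Data.List.Membership.Propositional using (_∈_)
open import Data.Product using (_×_; _,_)
open import Relation.Binary.PropositionalEquality using (_≡_)
open import Relation.Binary.Construct.Closure.Transitive using (TransClosure)
open import Relation.Nullary using (¬_)

Digraph : ℕ → Set
Digraph n = Fin n → Fin n → Bool

record OrientedGraph (n : ℕ) : Set where
  field
    arc    : Digraph n
    irrefl : ∀ i → arc i i ≡ false
    asym   : ∀ i j → arc i j ≡ true → arc j i ≡ false
open OrientedGraph public

Arc : ∀ {n} → Digraph n → Fin n → Fin n → Set
Arc A i j = A i j ≡ true

Acyclic : ∀ {n} → Digraph n → Set
Acyclic {n} A = ∀ (i : Fin n) → ¬ TransClosure (Arc A) i i

invert : ∀ {n} → Subset n → Digraph n → Digraph n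
invert X A i j = if lookup X i ∧ lookup X j then A j i else A i j

invertSeq : ∀ {n} → List (Subset n) → Digraph n → Digraph n
invertSeq S A = foldl (λ B X → invert X B) A S

IsPInversion : ∀ {n} → ℕ → Subset n → Set
IsPInversion p X = ∣ X ∣ ≡ p

DeletedArc : ∀ {n} → Digraph n → List (Fin n × Fin n) → Fin n → Fin n → Set
DeletedArc A F i j = Arc A i j × ¬ ((i , j) ∈ F)

AcyclicAfterDeleting : ∀ {n} → Digraph n → List (Fin n × Fin n) → Set
AcyclicAfterDeleting {n} A F = ∀ (i : Fin n) → ¬ TransClosure (DeletedArc A F) i i

module Submission where

-- Inverting X₁, …, X_k in turn reverses exactly the arcs whose two ends lie together in an odd
-- number of the Xᵢ (`invertSeq-covers`). So it suffices to find few p-sets whose pair parities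
-- single out the arcs that are backward for some linear order. Put a set R of p + 2 vertices
-- first and order the rest O topologically for D − F, so that the backward arcs inside O lie
-- in F. Each of these is toggled by one set {u, v} ∪ W with W ⊆ R fixed of size p − 2. Next,
-- for every o ∈ O at most p + 2 sets {o} ∪ Y with Y ⊆ R of size p − 1 correct the pairs
-- between o and R. Finally the sets R ∖ {a, b} realise every symmetric pattern of pairs of R
-- with an even number of pairs (this uses that |R| is even); if the remaining pattern is odd,
-- the first two vertices of R are swapped in the order, which changes its parity. Each layer
-- leaves the pairs settled by the previous ones untouched, and there are at most
-- |F| + n (p + 2) ≤ 2 |F| + 2 p n sets in total.

open import Defs
open import Data.Nat using (ℕ; _≤_; _<_; _+_; _*_)
open import Data.Nat.Divisibility using (_∣_)
open import Data.Fin using (Fin)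
open import Data.Fin.Subset using (Subset)
open import Data.List using (List; length)
open import Data.List.Relation.Unary.All using (All)
open import Data.List.Relation.Unary.Unique.Propositional using (Unique)
open import Data.Product using (_×_; _,_; ∃-syntax; proj₁; proj₂)

open import Algebra.Bundles using (CommutativeRing; CommutativeMonoid)
open import Data.Bool.Base using (Bool; true; false; not; _∧_; _∨_; _xor_; if_then_else_; T)
open import Data.Bool.Properties
  using ( xor-∧-commutativeRing; ∧-commutativeMonoid; not-involutive; if-xor; T-≡
        ; ∨-identityʳ; ∨-zeroʳ; ∨-comm; xor-same; xor-comm; xor-assoc; xor-identityʳ
        ; ∧-comm; ∧-assoc; ∧-zeroʳ; ∧-identityʳ; ∧-distribˡ-xor; ∧-distribʳ-xor )
open import Data.Empty using (⊥)
open import Data.Fin.Base using (zero; suc; toℕ; _↑ˡ_; _↑ʳ_; splitAt)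
import Data.Fin.Properties as Fin
open import Data.Fin.Subset using (∣_∣)
open import Data.Fin.Subset.Properties using (∣p∣≤n)
open import Data.List.Base using ([]; _∷_; _++_; map; concatMap; allFin; tabulate)
import Data.List.Properties as List
import Data.List.Relation.Unary.All as All
import Data.List.Relation.Unary.All.Properties as AllP
import Data.List.Relation.Unary.AllPairs as AllPairs
open import Data.Nat.Base using (zero; suc; z≤n; s≤s; _<ᵇ_)
open import Data.Nat.Divisibility using (divides)
open import Data.Nat.Properties
  using ( ≤-refl; ≤-reflexive; ≤-trans; <-trans; <-irrefl; <-cmp; ≤∧≢⇒<; ≮⇒≥; <⇒≢; <⇒≯; <ᵇ⇒<; <⇒<ᵇ; _<?_
        ; m≤n⇒m≤1+n; m≤m+n; m≤n⇒∃[o]m+o≡n; suc-injective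
        ; +-comm; +-assoc; +-suc; +-identityʳ; +-cancelˡ-≡; +-cancelʳ-≡; +-mono-≤; +-monoˡ-≤; +-monoʳ-<
        ; *-comm; *-distribʳ-+; *-monoˡ-≤; *-monoʳ-≤; module ≤-Reasoning )
open import Data.Sum.Base using (_⊎_; inj₁; inj₂)
import Data.Vec.Base as Vec
open import Data.Vec.Properties using (lookup∘tabulate; tabulate-cong)
import Data.Vec.Functional as Vector
open import Data.Vec.Functional.Properties using (lookup-++ˡ; lookup-++ʳ)
open import Function.Base using (id; _∘_; case_of_)
open import Relation.Binary.Construct.Closure.Transitive using (TransClosure; [_]; _∷_; _∷ʳ_)
open import Relation.Binary.Definitions using (DecidableEquality; tri<; tri≈; tri>)
open import Relation.Binary.PropositionalEquality
open import Relation.Nullary using (¬_; does; yes; no; contradiction)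
open import Relation.Nullary.Decidable using (dec-true; dec-false; does-⇔; map′; _×-dec_)
open import Function.Bundles using (Equivalence; mk⇔)

open import Algebra.Properties.CommutativeSemigroup (CommutativeMonoid.commutativeSemigroup ∧-commutativeMonoid)
  using () renaming (x∙yz≈y∙xz to ∧-left-comm)
open import Algebra.Properties.Semiring.Sum (CommutativeRing.semiring xor-∧-commutativeRing)
  using (sum-syntax; sum-cong-≗; ∑-distrib-+; ∑-comm; *-distribˡ-sum; sum-replicate-zero)

∧-true⁻ : ∀ {a b} → (a ∧ b) ≡ true → a ≡ true × b ≡ true
∧-true⁻ {true} {true} _ = refl , refl

_==_ : ∀ {n} → Fin n → Fin n → Bool
i == j = does (i Fin.≟ j)

==-sym : ∀ {n} (i j : Fin n) → (i == j) ≡ (j == i)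
==-sym i j = does-⇔ (mk⇔ sym sym) (i Fin.≟ j) (j Fin.≟ i)

<ᵇ-true⇒< : ∀ {m n} → (m <ᵇ n) ≡ true → m < n
<ᵇ-true⇒< {m} {n} m<ᵇn = <ᵇ⇒< m n (Equivalence.from T-≡ m<ᵇn)

<ᵇ-false⇒≮ : ∀ {m n} → (m <ᵇ n) ≡ false → ¬ (m < n)
<ᵇ-false⇒≮ m≮ᵇn m<n = subst T m≮ᵇn (<⇒<ᵇ m<n)

<⇒<ᵇ-true : ∀ {m n} → m < n → (m <ᵇ n) ≡ true
<⇒<ᵇ-true {m} {n} = dec-true (m <? n)

≮⇒<ᵇ-false : ∀ {m n} → ¬ (m < n) → (m <ᵇ n) ≡ false
≮⇒<ᵇ-false {m} {n} = dec-false (m <? n)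

_≺_ : ∀ {n} → Fin n → Fin n → Bool
a ≺ b = toℕ a <ᵇ toℕ b

≺-xor : ∀ {n} (a b : Fin n) → (a ≺ b) xor (b ≺ a) ≡ not (a == b)
≺-xor zero    zero    = refl
≺-xor zero    (suc b) = refl
≺-xor (suc a) zero    = refl
≺-xor (suc a) (suc b) = ≺-xor a b

≺⇒≢ : ∀ {n} {a b : Fin n} → (a ≺ b) ≡ true → a ≢ b
≺⇒≢ {a = a} a≺b refl = <-irrefl refl (<ᵇ-true⇒< {toℕ a} a≺b)

IsSymmetric : ∀ {n} → (Fin n → Fin n → Bool) → Set
IsSymmetric h = ∀ a b → h a b ≡ h b a

+-<ᵇ : ∀ k a b → (k + a <ᵇ k + b) ≡ (a <ᵇ b)
+-<ᵇ zero    a b = refl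
+-<ᵇ (suc k) a b = +-<ᵇ k a b

_≟₂_ : ∀ {n} → DecidableEquality (Fin n × Fin n)
(a , x) ≟₂ (b , y) = map′ (λ (a≡b , x≡y) → cong₂ _,_ a≡b x≡y) (λ { refl → refl , refl }) (a Fin.≟ b ×-dec x Fin.≟ y)

∑-select : ∀ {n} (x : Fin n) (f : Fin n → Bool) → ∑[ i < n ] ((i == x) ∧ f i) ≡ f x
∑-select {suc n} zero f = trans (cong (f zero xor_) (sum-replicate-zero n)) (xor-identityʳ (f zero))
∑-select {suc n} (suc x) f = ∑-select x (f ∘ suc)

∑-except : ∀ {n} (x : Fin n) (f : Fin n → Bool) → ∑[ i < n ] (not (i == x) ∧ f i) ≡ (∑[ i < n ] f i) xor f x
∑-except {n} x f = begin
  ∑[ i < n ] (not (i == x) ∧ f i)              ≡⟨ sum-cong-≗ (λ i → not-∧ (i == x) (f i)) ⟩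
  ∑[ i < n ] (f i xor ((i == x) ∧ f i))        ≡⟨ ∑-distrib-+ f (λ i → (i == x) ∧ f i) ⟩
  (∑[ i < n ] f i) xor ∑[ i < n ] ((i == x) ∧ f i) ≡⟨ cong ((∑[ i < n ] f i) xor_) (∑-select x f) ⟩
  (∑[ i < n ] f i) xor f x                     ∎
  where
  open ≡-Reasoning
  not-∧ : ∀ a b → (not a ∧ b) ≡ b xor (a ∧ b)
  not-∧ false b = sym (xor-identityʳ b)
  not-∧ true  b = sym (xor-same b)

∑-const : ∀ n c → ∑[ i < n ] c ≡ c ∧ ∑[ i < n ] true
∑-const n c = sym (trans (*-distribˡ-sum c (λ (_ : Fin n) → true)) (sum-cong-≗ {n} λ _ → ∧-identityʳ c))

∑-true-2+ : ∀ n → ∑[ i < 2 + n ] true ≡ ∑[ i < n ] true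
∑-true-2+ n = not-involutive (∑[ i < n ] true)

∑-even : ∀ q → ∑[ i < q * 2 ] true ≡ false
∑-even zero    = refl
∑-even (suc q) = trans (∑-true-2+ (q * 2)) (∑-even q)

⨁ : ∀ {A : Set} → List A → (A → Bool) → Bool
⨁ []       g = false
⨁ (x ∷ xs) g = g x xor ⨁ xs g

⨁-cong : ∀ {A : Set} (xs : List A) {g h : A → Bool} → (∀ x → g x ≡ h x) → ⨁ xs g ≡ ⨁ xs h
⨁-cong []       g≗h = refl
⨁-cong (x ∷ xs) g≗h = cong₂ _xor_ (g≗h x) (⨁-cong xs g≗h)

⨁-++ : ∀ {A : Set} (xs ys : List A) (g : A → Bool) → ⨁ (xs ++ ys) g ≡ ⨁ xs g xor ⨁ ys g
⨁-++ []       ys g = refl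
⨁-++ (x ∷ xs) ys g = trans (cong (g x xor_) (⨁-++ xs ys g)) (sym (xor-assoc (g x) _ _))

⨁-concatMap : ∀ {A B : Set} (f : A → List B) (xs : List A) (g : B → Bool) →
              ⨁ (concatMap f xs) g ≡ ⨁ xs (λ x → ⨁ (f x) g)
⨁-concatMap f []       g = refl
⨁-concatMap f (x ∷ xs) g =
  trans (⨁-++ (f x) (concatMap f xs) g) (cong (⨁ (f x) g xor_) (⨁-concatMap f xs g))

⨁-tabulate : ∀ {A : Set} n (f : Fin n → A) (g : A → Bool) → ⨁ (tabulate f) g ≡ ∑[ i < n ] g (f i)
⨁-tabulate zero    f g = refl
⨁-tabulate (suc n) f g = cong (g (f zero) xor_) (⨁-tabulate n (f ∘ suc) g)

select : ∀ {A B : Set} → (A → Bool) → (A → B) → List A → List B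
select c f []       = []
select c f (x ∷ xs) = if c x then f x ∷ select c f xs else select c f xs

module _ {A B : Set} (c : A → Bool) (f : A → B) where

  ⨁-select : (xs : List A) (g : B → Bool) → ⨁ (select c f xs) g ≡ ⨁ xs (λ x → c x ∧ g (f x))
  ⨁-select []       g = refl
  ⨁-select (x ∷ xs) g with c x
  ... | true  = cong (g (f x) xor_) (⨁-select xs g)
  ... | false = ⨁-select xs g

  length-select : (xs : List A) → length (select c f xs) ≤ length xs
  length-select []       = z≤n
  length-select (x ∷ xs) with c x
  ... | true  = s≤s (length-select xs)
  ... | false = m≤n⇒m≤1+n (length-select xs)

  All-select : {P : B → Set} {xs : List A} → All (λ x → c x ≡ true → P (f x)) xs → All P (select c f xs)
  All-select {xs = []}     All.[]         = All.[]
  All-select {xs = x ∷ xs} (Pfx All.∷ Pf) with c x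
  ... | true  = Pfx refl All.∷ All-select Pf
  ... | false = All-select Pf

length-concatMap-≤ : ∀ {A B : Set} (f : A → List B) (xs : List A) {k} →
                     (∀ x → length (f x) ≤ k) → length (concatMap f xs) ≤ length xs * k
length-concatMap-≤ f []       bound = z≤n
length-concatMap-≤ f (x ∷ xs) bound =
  ≤-trans (≤-reflexive (List.length-++ (f x))) (+-mono-≤ (bound x) (length-concatMap-≤ f xs bound))

All-concatMap : ∀ {A B : Set} {P : B → Set} (f : A → List B) (xs : List A) →
                (∀ x → All P (f x)) → All P (concatMap f xs)
All-concatMap f []       Pf = All.[]
All-concatMap f (x ∷ xs) Pf = AllP.++⁺ (Pf x) (All-concatMap f xs Pf)

⨁-map : ∀ {A B : Set} (f : A → B) (xs : List A) (g : B → Bool) → ⨁ (map f xs) g ≡ ⨁ xs (g ∘ f)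
⨁-map f []       g = refl
⨁-map f (x ∷ xs) g = cong (g (f x) xor_) (⨁-map f xs g)

⨁-∧ : ∀ {A : Set} (xs : List A) c (g : A → Bool) → ⨁ xs (λ x → c ∧ g x) ≡ c ∧ ⨁ xs g
⨁-∧ []       c g = sym (∧-zeroʳ c)
⨁-∧ (x ∷ xs) c g = trans (cong ((c ∧ g x) xor_) (⨁-∧ xs c g)) (sym (∧-distribˡ-xor c (g x) (⨁ xs g)))

⨁-false : ∀ {A : Set} (xs : List A) {g : A → Bool} → (∀ x → g x ≡ false) → ⨁ xs g ≡ false
⨁-false []       g≡false = refl
⨁-false (x ∷ xs) g≡false = cong₂ _xor_ (g≡false x) (⨁-false xs g≡false)

⨁-congᴬ : ∀ {A : Set} {P : A → Set} {xs : List A} {g h : A → Bool} →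
          All P xs → (∀ x → P x → g x ≡ h x) → ⨁ xs g ≡ ⨁ xs h
⨁-congᴬ All.[]         g≗h = refl
⨁-congᴬ (px All.∷ pxs) g≗h = cong₂ _xor_ (g≗h _ px) (⨁-congᴬ pxs g≗h)

module _ {A : Set} (_≟_ : DecidableEquality A) where

  open import Data.List.Membership.DecPropositional _≟_ using (_∈?_)

  ⨁-absent : ∀ {x xs} → All (x ≢_) xs → ⨁ xs (λ e → does (x ≟ e)) ≡ false
  ⨁-absent All.[]           = refl
  ⨁-absent (x≢e All.∷ x∉xs) = cong₂ _xor_ (dec-false (_ ≟ _) x≢e) (⨁-absent x∉xs)

  ⨁-occurrences : ∀ {xs} → Unique xs → ∀ x → ⨁ xs (λ e → does (x ≟ e)) ≡ does (x ∈? xs)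
  ⨁-occurrences {[]}     _                   x = refl
  ⨁-occurrences {e ∷ xs} (e∉xs AllPairs.∷ u) x with x ≟ e
  ... | yes refl = cong (true xor_) (⨁-absent e∉xs)
  ... | no _     = ⨁-occurrences u x

count : ∀ {n} → (Fin n → Bool) → ℕ
count f = ∣ Vec.tabulate f ∣

count-cong : ∀ {n} {f g : Fin n → Bool} → (∀ i → f i ≡ g i) → count f ≡ count g
count-cong f≗g = cong ∣_∣ (tabulate-cong f≗g)

count-false : ∀ n → count (λ (_ : Fin n) → false) ≡ 0
count-false zero    = refl
count-false (suc n) = count-false n

count-insert : ∀ {n} (f : Fin n → Bool) (x : Fin n) → f x ≡ false →
               count (λ i → (i == x) ∨ f i) ≡ suc (count f)
count-insert {suc n} f zero    fx rewrite fx = refl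
count-insert {suc n} f (suc x) fx with f zero
... | true  = cong suc (count-insert (f ∘ suc) x fx)
... | false = count-insert (f ∘ suc) x fx

count-pair : ∀ {n} (a b : Fin n) → a ≢ b → count (λ i → (i == a) xor (i == b)) ≡ 2
count-pair {n} a b a≢b = begin
  count (λ i → (i == a) xor (i == b))        ≡⟨ count-cong split ⟩
  count (λ i → (i == a) ∨ ((i == b) ∨ false)) ≡⟨ count-insert _ a (cong (_∨ false) (dec-false (a Fin.≟ b) a≢b)) ⟩
  suc (count (λ i → (i == b) ∨ false))        ≡⟨ cong suc (count-insert _ b refl) ⟩
  2 + count (λ (_ : Fin n) → false)          ≡⟨ cong (2 +_) (count-false n) ⟩
  2                                           ∎
  where
  open ≡-Reasoning
  split : ∀ i → ((i == a) xor (i == b)) ≡ ((i == a) ∨ ((i == b) ∨ false))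
  split i with i Fin.≟ a | i Fin.≟ b
  ... | yes refl | yes refl = contradiction refl a≢b
  ... | yes _    | no _     = refl
  ... | no _     | yes _    = refl
  ... | no _     | no _     = refl

count-not : ∀ {n} (f : Fin n → Bool) → count (not ∘ f) + count f ≡ n
count-not {zero}  f = refl
count-not {suc n} f with f zero
... | true  = trans (+-suc _ _) (cong suc (count-not (f ∘ suc)))
... | false = cong suc (count-not (f ∘ suc))

count-singleton : ∀ {n} (y : Fin n) → count (_== y) ≡ 1
count-singleton {n} y = trans (count-cong (λ w → sym (∨-identityʳ (w == y))))
                              (trans (count-insert (λ _ → false) y refl) (cong suc (count-false n)))

count-all-but : ∀ {n} (y : Fin (suc n)) → count (λ w → not (w == y)) ≡ n
count-all-but {n} y = +-cancelʳ-≡ 1 _ n (trans (cong (count (λ w → not (w == y)) +_) (sym (count-singleton y)))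
                                               (trans (count-not (_== y)) (+-comm 1 n)))

count-true : ∀ n → count (λ (_ : Fin n) → true) ≡ n
count-true zero    = refl
count-true (suc n) = cong suc (count-true n)

++-suc : ∀ {A : Set} {r m} (f : Fin (suc r) → A) (g : Fin m → A) i →
         (f Vector.++ g) (suc i) ≡ ((f ∘ suc) Vector.++ g) i
++-suc {r = r} f g i with splitAt r i
... | inj₁ _ = refl
... | inj₂ _ = refl

count-++ : ∀ {r m} (f : Fin r → Bool) (g : Fin m → Bool) → count (f Vector.++ g) ≡ count f + count g
count-++ {zero}  f g = refl
count-++ {suc r} f g with f zero
... | true  = cong suc (trans (count-cong (++-suc f g)) (count-++ (f ∘ suc) g))
... | false = trans (count-cong (++-suc f g)) (count-++ (f ∘ suc) g)

covers : ∀ {n} → List (Fin n → Bool) → Fin n → Fin n → Bool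
covers L i j = ⨁ L (λ X → X i ∧ X j)

covers-sym : ∀ {n} (L : List (Fin n → Bool)) i j → covers L i j ≡ covers L j i
covers-sym L i j = ⨁-cong L (λ X → ∧-comm (X i) (X j))

invert-tabulate : ∀ {n} (X : Fin n → Bool) (A : Digraph n) i j →
                  invert (Vec.tabulate X) A i j ≡ (if X i ∧ X j then A j i else A i j)
invert-tabulate X A i j rewrite lookup∘tabulate X i | lookup∘tabulate X j = refl

invertSeq-covers : ∀ {n} (L : List (Fin n → Bool)) (A : Digraph n) i j →
                   invertSeq (map Vec.tabulate L) A i j ≡ (if covers L i j then A j i else A i j)
invertSeq-covers []      A i j = refl
invertSeq-covers (X ∷ L) A i j = begin
  invertSeq (map Vec.tabulate L) (invert (Vec.tabulate X) A) i j
    ≡⟨ invertSeq-covers L _ i j ⟩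
  (if c then invert (Vec.tabulate X) A j i else invert (Vec.tabulate X) A i j)
    ≡⟨ cong₂ (if c then_else_) (trans (invert-tabulate X A j i) (cong (if_then A i j else A j i) (∧-comm (X j) (X i))))
                                (invert-tabulate X A i j) ⟩
  (if c then (if X i ∧ X j then A i j else A j i) else (if X i ∧ X j then A j i else A i j))
    ≡⟨ if-swap c (X i ∧ X j) ⟩
  (if X i ∧ X j then (if c then A i j else A j i) else (if c then A j i else A i j))
    ≡⟨ if-xor (X i ∧ X j) ⟨
  (if (X i ∧ X j) xor c then A j i else A i j) ∎
  where
  open ≡-Reasoning
  c = covers L i j
  if-swap : ∀ {B : Set} c b {x y : B} →
            (if c then (if b then x else y) else (if b then y else x)) ≡ (if b then (if c then x else y) else (if c then y else x))
  if-swap false false = refl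
  if-swap false true  = refl
  if-swap true  false = refl
  if-swap true  true  = refl

TransClosure-map : ∀ {n} {R S : Fin n → Fin n → Set} → (∀ {i j} → R i j → S i j) →
                   ∀ {i j} → TransClosure R i j → TransClosure S i j
TransClosure-map R⇒S [ i∼j ]      = [ R⇒S i∼j ]
TransClosure-map R⇒S (i∼k ∷ k∼⁺j) = R⇒S i∼k ∷ TransClosure-map R⇒S k∼⁺j

acyclic-by-rank : ∀ {n} (B : Digraph n) (π : Fin n → ℕ) → (∀ i j → Arc B i j → π i < π j) → Acyclic B
acyclic-by-rank B π increasing i cycle = <-irrefl refl (rank-increases cycle)
  where
  rank-increases : ∀ {x y} → TransClosure (Arc B) x y → π x < π y
  rank-increases [ x→y ]        = increasing _ _ x→y
  rank-increases (x→z ∷ z→⁺y) = <-trans (increasing _ _ x→z) (rank-increases z→⁺y)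

invertSeq-acyclic : ∀ {n} (A : Digraph n) (L : List (Fin n → Bool)) (π : Fin n → ℕ) →
  (∀ i → A i i ≡ false) → (∀ i j → π i ≡ π j → i ≡ j) →
  (∀ i j → Arc A i j → covers L i j ≡ (π j <ᵇ π i)) →
  Acyclic (invertSeq (map Vec.tabulate L) A)
invertSeq-acyclic A L π irreflexive π-injective reversed⇔backward =
  acyclic-by-rank _ π λ i j i→j → forward i j (subst (_≡ true) (invertSeq-covers L A i j) i→j)
  where
  forward : ∀ i j → (if covers L i j then A j i else A i j) ≡ true → π i < π j
  forward i j arc with covers L i j in reversed
  ... | true  = <ᵇ-true⇒< (trans (sym (reversed⇔backward j i arc)) (trans (covers-sym L j i) reversed))
  ... | false = ≤∧≢⇒< (≮⇒≥ (<ᵇ-false⇒≮ (trans (sym (reversed⇔backward i j arc)) reversed)))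
                      (λ πi≡πj → loop (π-injective i j πi≡πj) arc)
    where
    loop : i ≡ j → A i j ≡ true → ⊥
    loop refl a = case trans (sym (irreflexive i)) a of λ ()

anyᶠ : ∀ {n} → (Fin n → Bool) → Bool
anyᶠ {zero}  f = false
anyᶠ {suc n} f = f zero ∨ anyᶠ (f ∘ suc)

anyᶠ-intro : ∀ {n} (f : Fin n → Bool) x → f x ≡ true → anyᶠ f ≡ true
anyᶠ-intro f zero    fx rewrite fx = refl
anyᶠ-intro f (suc x) fx with f zero
... | true  = refl
... | false = anyᶠ-intro (f ∘ suc) x fx

anyᶠ-elim : ∀ {n} (f : Fin n → Bool) → anyᶠ f ≡ true → ∃[ x ] f x ≡ true
anyᶠ-elim {suc n} f any-f with f zero in f0
... | true  = zero , f0
... | false = let x , fx = anyᶠ-elim (f ∘ suc) any-f in suc x , fx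

module TopologicalRank {n : ℕ} (E : Digraph n) (acyclic : Acyclic E) where

  endsWalk : ℕ → Fin n → Bool
  endsWalk zero    i = true
  endsWalk (suc k) i = anyᶠ (λ j → E j i ∧ endsWalk k j)

  endsWalk-suc : ∀ {k j i} → Arc E j i → endsWalk k j ≡ true → endsWalk (suc k) i ≡ true
  endsWalk-suc {k} {j} {i} j→i walk = anyᶠ-intro (λ j → E j i ∧ endsWalk k j) j (cong₂ _∧_ j→i walk)

  _↝_ : Fin n → Fin n → Set
  x ↝ i = x ≡ i ⊎ TransClosure (Arc E) x i

  -- The vertices of a walk are pairwise distinct, as a repetition would close a cycle.
  walk-visits : ∀ k i → endsWalk k i ≡ true → ∃[ V ] count V ≡ suc k × (∀ x → V x ≡ true → x ↝ i)
  walk-visits zero i _ = (λ x → (x == i) ∨ false) , trans (count-insert _ i refl) (cong suc (count-false n)) , reaches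
    where
    reaches : ∀ x → ((x == i) ∨ false) ≡ true → x ↝ i
    reaches x _ with x Fin.≟ i
    ... | yes x≡i = inj₁ x≡i
  walk-visits (suc k) i walk with anyᶠ-elim (λ j → E j i ∧ endsWalk k j) walk
  ... | j , step with ∧-true⁻ step
  ...   | j→i , walkⱼ with walk-visits k j walkⱼ
  ...     | V , |V| , reachesⱼ with V i in Vi
  ...       | true  = contradiction (closing (reachesⱼ i Vi)) (acyclic i)
    where
    closing : i ↝ j → TransClosure (Arc E) i i
    closing (inj₁ refl)  = [ j→i ]
    closing (inj₂ i→⁺j) = i→⁺j ∷ʳ j→i
  ...       | false = (λ x → (x == i) ∨ V x) , trans (count-insert V i Vi) (cong suc |V|) , reaches
    where
    reaches : ∀ x → ((x == i) ∨ V x) ≡ true → x ↝ i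
    reaches x x∈V′ with x Fin.≟ i
    ... | yes x≡i = inj₁ x≡i
    ... | no _ with reachesⱼ x x∈V′
    ...   | inj₁ refl = inj₂ [ j→i ]
    ...   | inj₂ x→⁺j = inj₂ (x→⁺j ∷ʳ j→i)

  no-walk-of-length-n : ∀ i → endsWalk n i ≡ false
  no-walk-of-length-n i with endsWalk n i in walk
  ... | false = refl
  ... | true  = let V , |V| , _ = walk-visits n i walk in
                contradiction (subst (_≤ n) |V| (∣p∣≤n (Vec.tabulate V))) (<-irrefl refl)

  depth : ℕ → Fin n → ℕ
  depth zero    i = 0
  depth (suc m) i = depth m i + (if endsWalk m i then 1 else 0)

  depth-step : ∀ {j i} → Arc E j i → ∀ m → suc (depth m j) ≤ depth (suc m) i
  depth-step j→i zero    = ≤-refl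
  depth-step {j} {i} j→i (suc m) = +-mono-≤ (depth-step j→i m) (indicator-mono (endsWalk-suc {m} j→i))
    where
    indicator-mono : ∀ {a b} → (a ≡ true → b ≡ true) → (if a then 1 else 0) ≤ (if b then 1 else 0)
    indicator-mono {false}         _   = z≤n
    indicator-mono {true} {true}   _   = ≤-refl
    indicator-mono {true} {false}  a⇒b = case a⇒b refl of λ ()

  depth-increases : ∀ {j i} → Arc E j i → depth n j < depth n i
  depth-increases {j} {i} j→i = subst (suc (depth n j) ≤_) last-step-empty (depth-step j→i n)
    where
    last-step-empty : depth (suc n) i ≡ depth n i
    last-step-empty rewrite no-walk-of-length-n i = +-identityʳ (depth n i)

module _ {n : ℕ} where

  tiebreak-< : ∀ {a b} (i j : Fin n) → a < b → a * n + toℕ i < b * n + toℕ j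
  tiebreak-< {a} {b} i j a<b = begin-strict
    a * n + toℕ i  <⟨ +-monoʳ-< (a * n) (Fin.toℕ<n i) ⟩
    a * n + n      ≡⟨ +-comm (a * n) n ⟩
    suc a * n      ≤⟨ *-monoˡ-≤ n a<b ⟩
    b * n          ≤⟨ m≤m+n (b * n) (toℕ j) ⟩
    b * n + toℕ j  ∎
    where open ≤-Reasoning

  tiebreak-injective : (d : Fin n → ℕ) → ∀ i j → d i * n + toℕ i ≡ d j * n + toℕ j → i ≡ j
  tiebreak-injective d i j eq with <-cmp (d i) (d j)
  ... | tri< di<dj _ _ = contradiction eq (<⇒≢ (tiebreak-< i j di<dj))
  ... | tri> _ _ dj<di = contradiction (sym eq) (<⇒≢ (tiebreak-< j i dj<di))
  ... | tri≈ _ di≡dj _ = Fin.toℕ-injective (+-cancelˡ-≡ (d i * n) _ _ (trans eq (cong (λ e → e * n + toℕ j) (sym di≡dj))))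

topological-rank : ∀ {n} (E : Digraph n) → Acyclic E →
                   ∃[ ρ ] (∀ i j → Arc E i j → ρ i < ρ j) × (∀ i j → ρ i ≡ ρ j → i ≡ j)
topological-rank {n} E acyclic =
  (λ i → depth n i * n + toℕ i) ,
  (λ i j i→j → tiebreak-< i j (depth-increases i→j)) ,
  tiebreak-injective (depth n)
  where open TopologicalRank E acyclic

module UnorderedPairs {r : ℕ} where

  ∑ᵤ : (Fin r → Fin r → Bool) → Bool
  ∑ᵤ h = ∑[ a < r ] ∑[ b < r ] ((a ≺ b) ∧ h a b)

  incident : Fin r → Fin r → Fin r → Bool
  incident x a b = (a == x) xor (b == x)

  incident-sym : ∀ x → IsSymmetric (incident x)
  incident-sym x a b = xor-comm (a == x) (b == x)

  ∑ᵤ-cong : ∀ {h h′} → (∀ a b → h a b ≡ h′ a b) → ∑ᵤ h ≡ ∑ᵤ h′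
  ∑ᵤ-cong h≗h′ = sum-cong-≗ λ a → sum-cong-≗ λ b → cong ((a ≺ b) ∧_) (h≗h′ a b)

  ∑ᵤ-xor : ∀ h h′ → ∑ᵤ (λ a b → h a b xor h′ a b) ≡ ∑ᵤ h xor ∑ᵤ h′
  ∑ᵤ-xor h h′ = trans
    (sum-cong-≗ λ a → trans (sum-cong-≗ λ b → ∧-distribˡ-xor (a ≺ b) (h a b) (h′ a b))
                            (∑-distrib-+ (λ b → (a ≺ b) ∧ h a b) (λ b → (a ≺ b) ∧ h′ a b)))
    (∑-distrib-+ (λ a → ∑[ b < r ] ((a ≺ b) ∧ h a b)) (λ a → ∑[ b < r ] ((a ≺ b) ∧ h′ a b)))

  ∑ᵤ-∧ : ∀ c h → ∑ᵤ (λ a b → c ∧ h a b) ≡ c ∧ ∑ᵤ h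
  ∑ᵤ-∧ c h = sym (trans (*-distribˡ-sum c λ a → ∑[ b < r ] ((a ≺ b) ∧ h a b)) (sum-cong-≗ λ a →
               trans (*-distribˡ-sum c λ b → (a ≺ b) ∧ h a b) (sum-cong-≗ λ b → ∧-left-comm c (a ≺ b) (h a b))))

  ∑ᵤ-from : ∀ x (h : Fin r → Fin r → Bool) → ∑ᵤ (λ a b → (a == x) ∧ h a b) ≡ ∑[ b < r ] ((x ≺ b) ∧ h x b)
  ∑ᵤ-from x h = trans
    (sum-cong-≗ λ a → trans (sum-cong-≗ λ b → ∧-left-comm (a ≺ b) (a == x) (h a b))
                            (sym (*-distribˡ-sum (a == x) λ b → (a ≺ b) ∧ h a b)))
    (∑-select x λ a → ∑[ b < r ] ((a ≺ b) ∧ h a b))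

  ∑ᵤ-to : ∀ x (h : Fin r → Fin r → Bool) → ∑ᵤ (λ a b → (b == x) ∧ h a b) ≡ ∑[ a < r ] ((a ≺ x) ∧ h a x)
  ∑ᵤ-to x h = trans (∑-comm λ a b → (a ≺ b) ∧ ((b == x) ∧ h a b)) (trans
    (sum-cong-≗ λ b → trans (sum-cong-≗ λ a → ∧-left-comm (a ≺ b) (b == x) (h a b))
                            (sym (*-distribˡ-sum (b == x) λ a → (a ≺ b) ∧ h a b)))
    (∑-select x λ b → ∑[ a < r ] ((a ≺ b) ∧ h a b)))

  ∑ᵤ-incident : ∀ x (h : Fin r → Fin r → Bool) → IsSymmetric h →
                ∑ᵤ (λ a b → incident x a b ∧ h a b) ≡ ∑[ b < r ] (not (b == x) ∧ h x b)
  ∑ᵤ-incident x h h-sym = begin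
    ∑ᵤ (λ a b → incident x a b ∧ h a b)
      ≡⟨ ∑ᵤ-cong (λ a b → ∧-distribʳ-xor (h a b) (a == x) (b == x)) ⟩
    ∑ᵤ (λ a b → ((a == x) ∧ h a b) xor ((b == x) ∧ h a b))
      ≡⟨ ∑ᵤ-xor _ _ ⟩
    ∑ᵤ (λ a b → (a == x) ∧ h a b) xor ∑ᵤ (λ a b → (b == x) ∧ h a b)
      ≡⟨ cong₂ _xor_ (∑ᵤ-from x h) (trans (∑ᵤ-to x h) (sum-cong-≗ λ b → cong ((b ≺ x) ∧_) (h-sym b x))) ⟩
    ∑[ b < r ] ((x ≺ b) ∧ h x b) xor ∑[ b < r ] ((b ≺ x) ∧ h x b)
      ≡⟨ ∑-distrib-+ (λ b → (x ≺ b) ∧ h x b) (λ b → (b ≺ x) ∧ h x b) ⟨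
    ∑[ b < r ] (((x ≺ b) ∧ h x b) xor ((b ≺ x) ∧ h x b))
      ≡⟨ sum-cong-≗ (λ b → trans (sym (∧-distribʳ-xor (h x b) (x ≺ b) (b ≺ x)))
                                 (cong (_∧ h x b) (trans (≺-xor x b) (cong not (==-sym x b))))) ⟩
    ∑[ b < r ] (not (b == x) ∧ h x b) ∎
    where open ≡-Reasoning

  ∑ᵤ-incident₂ : ∀ {x y} (h : Fin r → Fin r → Bool) → x ≢ y → IsSymmetric h →
                 ∑ᵤ (λ a b → incident x a b ∧ (incident y a b ∧ h a b)) ≡ h x y
  ∑ᵤ-incident₂ {x} {y} h x≢y h-sym = begin
    ∑ᵤ (λ a b → incident x a b ∧ (incident y a b ∧ h a b))
      ≡⟨ ∑ᵤ-incident x _ (λ a b → cong₂ _∧_ (incident-sym y a b) (h-sym a b)) ⟩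
    ∑[ b < r ] (not (b == x) ∧ (((x == y) xor (b == y)) ∧ h x b))
      ≡⟨ sum-cong-≗ (λ b → trans (cong (λ e → not (b == x) ∧ ((e xor (b == y)) ∧ h x b)) (dec-false (x Fin.≟ y) x≢y))
                                 (∧-left-comm (not (b == x)) (b == y) (h x b))) ⟩
    ∑[ b < r ] ((b == y) ∧ (not (b == x) ∧ h x b))
      ≡⟨ ∑-select y (λ b → not (b == x) ∧ h x b) ⟩
    not (y == x) ∧ h x y
      ≡⟨ cong (λ e → not e ∧ h x y) (dec-false (y Fin.≟ x) (x≢y ∘ sym)) ⟩
    h x y ∎
    where open ≡-Reasoning

  ∑ᵤ-swap : (g : Fin r → Fin r → Fin r → Bool) →
            ∑[ x < r ] ∑ᵤ (g x) ≡ ∑ᵤ (λ a b → ∑[ x < r ] g x a b)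
  ∑ᵤ-swap g = trans (∑-comm λ x a → ∑[ b < r ] ((a ≺ b) ∧ g x a b)) (sum-cong-≗ λ a →
              trans (∑-comm λ x b → (a ≺ b) ∧ g x a b) (sum-cong-≗ λ b →
              sym (*-distribˡ-sum (a ≺ b) λ x → g x a b)))

  ∑-incident : ∀ a b (f : Fin r → Bool) → ∑[ x < r ] (incident x a b ∧ f x) ≡ f a xor f b
  ∑-incident a b f = begin
    ∑[ x < r ] (incident x a b ∧ f x)
      ≡⟨ sum-cong-≗ (λ x → ∧-distribʳ-xor (f x) (a == x) (b == x)) ⟩
    ∑[ x < r ] (((a == x) ∧ f x) xor ((b == x) ∧ f x))
      ≡⟨ ∑-distrib-+ (λ x → (a == x) ∧ f x) (λ x → (b == x) ∧ f x) ⟩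
    ∑[ x < r ] ((a == x) ∧ f x) xor ∑[ x < r ] ((b == x) ∧ f x)
      ≡⟨ cong₂ _xor_ (select-at a) (select-at b) ⟩
    f a xor f b ∎
    where
    open ≡-Reasoning
    select-at : ∀ c → ∑[ x < r ] ((c == x) ∧ f x) ≡ f c
    select-at c = trans (sum-cong-≗ λ x → cong (_∧ f x) (==-sym c x)) (∑-select c f)

  ∑ᵤ-handshake : (h : Fin r → Fin r → Bool) → ∑[ x < r ] ∑ᵤ (λ a b → incident x a b ∧ h a b) ≡ false
  ∑ᵤ-handshake h = begin
    ∑[ x < r ] ∑ᵤ (λ a b → incident x a b ∧ h a b)
      ≡⟨ ∑ᵤ-swap (λ x a b → incident x a b ∧ h a b) ⟩
    ∑ᵤ (λ a b → ∑[ x < r ] (incident x a b ∧ h a b))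
      ≡⟨ ∑ᵤ-cong (λ a b → trans (∑-incident a b (λ _ → h a b)) (xor-same (h a b))) ⟩
    ∑ᵤ (λ _ _ → false)
      ≡⟨ ∑ᵤ-∧ false (λ _ _ → false) ⟩
    false ∎
    where open ≡-Reasoning

  module _ (r-even : ∑[ i < r ] true ≡ false) where

    ∑-≢ : ∀ x → ∑[ b < r ] (not (b == x) ∧ true) ≡ true
    ∑-≢ x = trans (∑-except x (λ _ → true)) (cong (_xor true) r-even)

    ∑ᵤ-endpoints : (f : Fin r → Bool) → ∑ᵤ (λ a b → f a xor f b) ≡ ∑[ x < r ] f x
    ∑ᵤ-endpoints f = begin
      ∑ᵤ (λ a b → f a xor f b)
        ≡⟨ ∑ᵤ-cong (λ a b → sym (∑-incident a b f)) ⟩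
      ∑ᵤ (λ a b → ∑[ x < r ] (incident x a b ∧ f x))
        ≡⟨ ∑ᵤ-swap (λ x a b → incident x a b ∧ f x) ⟨
      ∑[ x < r ] ∑ᵤ (λ a b → incident x a b ∧ f x)
        ≡⟨ sum-cong-≗ (λ x → trans (∑ᵤ-cong (λ a b → ∧-comm (incident x a b) (f x)))
                         (trans (∑ᵤ-∧ (f x) (incident x)) (cong (f x ∧_) (incident-count x)))) ⟩
      ∑[ x < r ] (f x ∧ true)
        ≡⟨ sum-cong-≗ (λ x → ∧-identityʳ (f x)) ⟩
      ∑[ x < r ] f x ∎
      where
      open ≡-Reasoning
      incident-count : ∀ x → ∑ᵤ (incident x) ≡ true
      incident-count x = trans (∑ᵤ-cong (λ a b → sym (∧-identityʳ (incident x a b))))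
                               (trans (∑ᵤ-incident x (λ _ _ → true) (λ _ _ → refl)) (∑-≢ x))

is01 : ∀ {q} → Fin (2 + q) → Fin (2 + q) → Bool
is01 a b = incident zero a b ∧ incident (suc zero) a b
  where open UnorderedPairs

module PairGadget {q : ℕ} (r-even : ∑[ i < 2 + q ] true ≡ false)
                  (T : Fin (2 + q) → Fin (2 + q) → Bool) (T-sym : IsSymmetric T) where

  open UnorderedPairs {2 + q}

  r : ℕ
  r = 2 + q

  parity : Bool
  parity = ∑ᵤ T

  T′ : Fin r → Fin r → Bool
  T′ a b = T a b xor (parity ∧ is01 a b)

  degree : Fin r → Bool
  degree x = ∑[ b < r ] (not (b == x) ∧ T′ x b)

  -- Weighting the sets `avoiding a b` by E gives the pair {x, y} the parity
  -- ∑ᵤ E + deg_E x + deg_E y + E x y; for this E the degrees are `degree` and ∑ᵤ E vanishes.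
  E : Fin r → Fin r → Bool
  E a b = T′ a b xor (degree a xor degree b)

  avoiding : Fin r → Fin r → Fin r → Bool
  avoiding a b x = not (incident x a b)

  family : List (Fin r → Bool)
  family = concatMap (λ a → select (λ b → (a ≺ b) ∧ E a b) (avoiding a) (allFin r)) (allFin r)

  T′-sym : IsSymmetric T′
  T′-sym a b = cong₂ (λ u v → u xor (parity ∧ v)) (T-sym a b)
                     (cong₂ _∧_ (incident-sym zero a b) (incident-sym (suc zero) a b))

  E-sym : IsSymmetric E
  E-sym a b = cong₂ _xor_ (T′-sym a b) (xor-comm (degree a) (degree b))

  ∑ᵤ-T′ : ∑ᵤ T′ ≡ false
  ∑ᵤ-T′ = begin
    ∑ᵤ T′                                    ≡⟨ ∑ᵤ-xor T (λ a b → parity ∧ is01 a b) ⟩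
    parity xor ∑ᵤ (λ a b → parity ∧ is01 a b) ≡⟨ cong (parity xor_) (∑ᵤ-∧ parity is01) ⟩
    parity xor (parity ∧ ∑ᵤ is01)             ≡⟨ cong (λ e → parity xor (parity ∧ e)) ∑ᵤ-is01 ⟩
    parity xor (parity ∧ true)                ≡⟨ cong (parity xor_) (∧-identityʳ parity) ⟩
    parity xor parity                         ≡⟨ xor-same parity ⟩
    false                                     ∎
    where
    open ≡-Reasoning
    ∑ᵤ-is01 : ∑ᵤ is01 ≡ true
    ∑ᵤ-is01 = trans (∑ᵤ-cong (λ a b → cong (incident zero a b ∧_) (sym (∧-identityʳ (incident (suc zero) a b)))))
                    (∑ᵤ-incident₂ {zero} {suc zero} (λ _ _ → true) (λ ()) (λ _ _ → refl))

  degree-incident : ∀ x → ∑ᵤ (λ a b → incident x a b ∧ T′ a b) ≡ degree x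
  degree-incident x = ∑ᵤ-incident x T′ T′-sym

  ∑-degree : ∑[ x < r ] degree x ≡ false
  ∑-degree = trans (sum-cong-≗ (λ x → sym (degree-incident x))) (∑ᵤ-handshake T′)

  ∑ᵤ-E : ∑ᵤ E ≡ false
  ∑ᵤ-E = begin
    ∑ᵤ E                                                   ≡⟨ ∑ᵤ-xor T′ (λ a b → degree a xor degree b) ⟩
    ∑ᵤ T′ xor ∑ᵤ (λ a b → degree a xor degree b)           ≡⟨ cong₂ _xor_ ∑ᵤ-T′ (∑ᵤ-endpoints r-even degree) ⟩
    false xor ∑[ x < r ] degree x                          ≡⟨ ∑-degree ⟩
    false                                                  ∎
    where open ≡-Reasoning

  E-degree : ∀ x → ∑ᵤ (λ a b → incident x a b ∧ E a b) ≡ degree x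
  E-degree x = begin
    ∑ᵤ (λ a b → incident x a b ∧ E a b)
      ≡⟨ ∑ᵤ-incident x E E-sym ⟩
    ∑[ b < r ] (not (b == x) ∧ (T′ x b xor (degree x xor degree b)))
      ≡⟨ sum-cong-≗ (λ b → distribute (not (b == x)) (T′ x b) (degree x) (degree b)) ⟩
    ∑[ b < r ] ((((not (b == x) ∧ T′ x b) xor (degree x ∧ (not (b == x) ∧ true))) xor (not (b == x) ∧ degree b)))
      ≡⟨ trans (∑-distrib-+ (λ b → (not (b == x) ∧ T′ x b) xor (degree x ∧ (not (b == x) ∧ true)))
                            (λ b → not (b == x) ∧ degree b))
               (cong (_xor ∑[ b < r ] (not (b == x) ∧ degree b)) (∑-distrib-+ (λ b → not (b == x) ∧ T′ x b) (λ b → degree x ∧ (not (b == x) ∧ true)))) ⟩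
    (degree x xor ∑[ b < r ] (degree x ∧ (not (b == x) ∧ true))) xor ∑[ b < r ] (not (b == x) ∧ degree b)
      ≡⟨ cong₂ (λ u v → (degree x xor u) xor v)
               (trans (sym (*-distribˡ-sum (degree x) (λ b → not (b == x) ∧ true)))
                      (trans (cong (degree x ∧_) (∑-≢ r-even x)) (∧-identityʳ (degree x))))
               (trans (∑-except x degree) (cong (_xor degree x) ∑-degree)) ⟩
    (degree x xor degree x) xor (false xor degree x)
      ≡⟨ cong (_xor degree x) (xor-same (degree x)) ⟩
    degree x ∎
    where
    open ≡-Reasoning
    distribute : ∀ c u d e → (c ∧ (u xor (d xor e))) ≡ (((c ∧ u) xor (d ∧ (c ∧ true))) xor (c ∧ e))
    distribute false u d e = sym (cong (_xor false) (∧-zeroʳ d))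
    distribute true  u d e = sym (trans (cong (λ z → (u xor z) xor e) (∧-identityʳ d)) (xor-assoc u d e))

  family-covers : ∀ x y → x ≢ y → covers family x y ≡ T′ x y
  family-covers x y x≢y = begin
    covers family x y
      ≡⟨ ⨁-concatMap row (allFin r) (λ X → X x ∧ X y) ⟩
    ⨁ (allFin r) (λ a → ⨁ (row a) (λ X → X x ∧ X y))
      ≡⟨ ⨁-tabulate r (λ a → a) (λ a → ⨁ (row a) (λ X → X x ∧ X y)) ⟩
    ∑[ a < r ] ⨁ (row a) (λ X → X x ∧ X y)
      ≡⟨ sum-cong-≗ (λ a → trans (⨁-select (λ b → (a ≺ b) ∧ E a b) (avoiding a) (allFin r) (λ X → X x ∧ X y))
                         (trans (⨁-tabulate r (λ b → b) (λ b → ((a ≺ b) ∧ E a b) ∧ (avoiding a b x ∧ avoiding a b y)))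
                                (sum-cong-≗ λ b → ∧-assoc (a ≺ b) (E a b) (avoiding a b x ∧ avoiding a b y)))) ⟩
    ∑ᵤ (λ a b → E a b ∧ (avoiding a b x ∧ avoiding a b y))
      ≡⟨ ∑ᵤ-cong (λ a b → expand (E a b) (incident x a b) (incident y a b)) ⟩
    ∑ᵤ (λ a b → ((E a b xor (incident x a b ∧ E a b)) xor (incident y a b ∧ E a b))
                 xor (incident x a b ∧ (incident y a b ∧ E a b)))
      ≡⟨ trans (∑ᵤ-xor (λ a b → (E a b xor x∈ a b) xor y∈ a b) xy∈)
               (cong (_xor ∑ᵤ xy∈) (trans (∑ᵤ-xor (λ a b → E a b xor x∈ a b) y∈)
                                          (cong (_xor ∑ᵤ y∈) (∑ᵤ-xor E x∈)))) ⟩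
    ((∑ᵤ E xor ∑ᵤ (λ a b → incident x a b ∧ E a b)) xor ∑ᵤ (λ a b → incident y a b ∧ E a b))
      xor ∑ᵤ (λ a b → incident x a b ∧ (incident y a b ∧ E a b))
      ≡⟨ cong₂ _xor_ (cong₂ _xor_ (cong₂ _xor_ ∑ᵤ-E (E-degree x)) (E-degree y)) (∑ᵤ-incident₂ E x≢y E-sym) ⟩
    ((false xor degree x) xor degree y) xor (T′ x y xor (degree x xor degree y))
      ≡⟨ cancel (degree x) (degree y) (T′ x y) ⟩
    T′ x y ∎
    where
    open ≡-Reasoning
    x∈ y∈ xy∈ : Fin r → Fin r → Bool
    x∈ a b = incident x a b ∧ E a b
    y∈ a b = incident y a b ∧ E a b
    xy∈ a b = incident x a b ∧ (incident y a b ∧ E a b)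
    row : Fin r → List (Fin r → Bool)
    row a = select (λ b → (a ≺ b) ∧ E a b) (avoiding a) (allFin r)
    expand : ∀ e u v → (e ∧ (not u ∧ not v)) ≡ (((e xor (u ∧ e)) xor (v ∧ e)) xor (u ∧ (v ∧ e)))
    expand false false false = refl
    expand false false true  = refl
    expand false true  false = refl
    expand false true  true  = refl
    expand true  false false = refl
    expand true  false true  = refl
    expand true  true  false = refl
    expand true  true  true  = refl
    cancel : ∀ d d′ t → ((false xor d) xor d′) xor (t xor (d xor d′)) ≡ t
    cancel false false t = xor-identityʳ t
    cancel false true  t = trans (cong (true xor_) (xor-comm t true)) (sym (xor-assoc true true t))
    cancel true  false t = trans (cong (true xor_) (xor-comm t true)) (sym (xor-assoc true true t))
    cancel true  true  t = xor-identityʳ t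

  avoiding-size : ∀ a b → a ≢ b → count (avoiding a b) ≡ q
  avoiding-size a b a≢b = +-cancelʳ-≡ 2 (count (avoiding a b)) q (begin
    count (avoiding a b) + 2                                ≡⟨ cong (count (avoiding a b) +_) (sym pair-size) ⟩
    count (avoiding a b) + count (λ x → incident x a b)     ≡⟨ count-not (λ x → incident x a b) ⟩
    2 + q                                                   ≡⟨ +-comm 2 q ⟩
    q + 2                                                   ∎)
    where
    open ≡-Reasoning
    pair-size : count (λ x → incident x a b) ≡ 2
    pair-size = trans (count-cong (λ x → cong₂ _xor_ (==-sym a x) (==-sym b x))) (count-pair a b a≢b)

  family-sizes : All (λ X → count X ≡ q) family
  family-sizes = All-concatMap (λ a → select (λ b → (a ≺ b) ∧ E a b) (avoiding a) (allFin r)) (allFin r) λ a →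
    All-select (λ b → (a ≺ b) ∧ E a b) (avoiding a) {xs = allFin r} (AllP.tabulate⁺ {f = id} λ b selected →
      avoiding-size a b (≺⇒≢ (proj₁ (∧-true⁻ selected))))

  family-length : length family ≤ r * r
  family-length = subst (λ k → length family ≤ k * r) (List.length-tabulate {n = r} id)
    (length-concatMap-≤ (λ a → select (λ b → (a ≺ b) ∧ E a b) (avoiding a) (allFin r)) (allFin r) λ a →
       ≤-trans (length-select (λ b → (a ≺ b) ∧ E a b) (avoiding a) (allFin r)) (≤-reflexive (List.length-tabulate {n = r} id)))

relabel : ∀ {q} → Bool → Fin (2 + q) → ℕ
relabel false a                   = toℕ a
relabel true  zero                = 1
relabel true  (suc zero)          = 0
relabel true  a@(suc (suc _))     = toℕ a

relabel-< : ∀ {q} ε (a : Fin (2 + q)) → relabel ε a < 2 + q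
relabel-< false a                 = Fin.toℕ<n a
relabel-< true  zero              = s≤s (s≤s z≤n)
relabel-< true  (suc zero)        = s≤s z≤n
relabel-< true  a@(suc (suc _))   = Fin.toℕ<n a

relabel-injective : ∀ {q} ε (a b : Fin (2 + q)) → relabel ε a ≡ relabel ε b → a ≡ b
relabel-injective false a b eq = Fin.toℕ-injective eq
relabel-injective true zero             zero             eq = refl
relabel-injective true (suc zero)       (suc zero)       eq = refl
relabel-injective true (suc (suc a))    (suc (suc b))    eq = Fin.toℕ-injective eq
relabel-injective true zero             (suc (suc b))    eq = case suc-injective eq of λ ()
relabel-injective true (suc (suc a))    zero             eq = case suc-injective eq of λ ()
relabel-injective true zero             (suc zero)       ()
relabel-injective true (suc zero)       zero             ()
relabel-injective true (suc zero)       (suc (suc b))    ()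
relabel-injective true (suc (suc a))    (suc zero)       ()

relabel-order : ∀ {q} ε (a b : Fin (2 + q)) → a ≢ b →
                (b ≺ a) xor (ε ∧ is01 a b) ≡ (relabel ε b <ᵇ relabel ε a)
relabel-order false a b _ = xor-identityʳ (b ≺ a)
relabel-order true zero             zero             a≢b = contradiction refl a≢b
relabel-order true (suc zero)       (suc zero)       a≢b = contradiction refl a≢b
relabel-order true zero             (suc zero)       _   = refl
relabel-order true zero             (suc (suc b))    _   = refl
relabel-order true (suc zero)       zero             _   = refl
relabel-order true (suc zero)       (suc (suc b))    _   = refl
relabel-order true (suc (suc a))    zero             _   = refl
relabel-order true (suc (suc a))    (suc zero)       _   = refl
relabel-order true (suc (suc a))    (suc (suc b))    _   = xor-identityʳ (suc (suc b) ≺ suc (suc a))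

module StarGadget {p₀ : ℕ} (p₀-even : ∑[ i < p₀ ] true ≡ false) (Z : Fin (4 + p₀) → Bool) where

  outside01 : Fin (2 + p₀) → Bool
  outside01 zero             = false
  outside01 (suc zero)       = false
  outside01 (suc (suc _))    = true

  avoiding01 : Fin (2 + p₀) → Fin (4 + p₀) → Bool
  avoiding01 y zero          = false
  avoiding01 y (suc zero)    = false
  avoiding01 y (suc (suc w)) = not (w == y)

  avoiding023 avoiding123 : Fin (4 + p₀) → Bool
  avoiding023 zero          = false
  avoiding023 (suc zero)    = true
  avoiding023 (suc (suc w)) = outside01 w
  avoiding123 zero          = true
  avoiding123 (suc zero)    = false
  avoiding123 (suc (suc w)) = outside01 w

  middleSum : Bool
  middleSum = ∑[ v < 2 + p₀ ] Z (suc (suc v))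

  -- At vertex 2 + w the family below has parity (∑ weight) + weight w + (Z 0 + Z 1) ∧ outside01 w,
  -- which these weights turn into Z (2 + w) because ∑ weight = middleSum (`∑-weight`).
  weight : Fin (2 + p₀) → Bool
  weight w = Z (suc (suc w)) xor (middleSum xor ((Z zero xor Z (suc zero)) ∧ outside01 w))

  extras : List (Bool × (Fin (4 + p₀) → Bool))
  extras = (Z (suc zero) , avoiding023) ∷ (Z zero , avoiding123) ∷ []

  candidates : List (Bool × (Fin (4 + p₀) → Bool))
  candidates = tabulate (λ y → weight y , avoiding01 y) ++ extras

  family : List (Fin (4 + p₀) → Bool)
  family = select proj₁ proj₂ candidates

  ∑-weight : ∑[ w < 2 + p₀ ] weight w ≡ middleSum
  ∑-weight = begin
    ∑[ w < 2 + p₀ ] weight w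
      ≡⟨ ∑-distrib-+ (λ w → Z (suc (suc w))) (λ w → middleSum xor (ab ∧ outside01 w)) ⟩
    middleSum xor ∑[ w < 2 + p₀ ] (middleSum xor (ab ∧ outside01 w))
      ≡⟨ cong (middleSum xor_) (∑-distrib-+ (λ _ → middleSum) (λ w → ab ∧ outside01 w)) ⟩
    middleSum xor (∑[ w < 2 + p₀ ] middleSum xor ∑[ w < 2 + p₀ ] (ab ∧ outside01 w))
      ≡⟨ cong (λ e → middleSum xor (e xor ∑[ w < 2 + p₀ ] (ab ∧ outside01 w)))
              (trans (∑-const (2 + p₀) middleSum) (trans (cong (middleSum ∧_) (trans (∑-true-2+ p₀) p₀-even)) (∧-zeroʳ middleSum))) ⟩
    middleSum xor (false xor ∑[ w < 2 + p₀ ] (ab ∧ outside01 w))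
      ≡⟨ cong (middleSum xor_) (trans (sym (*-distribˡ-sum ab outside01)) (trans (cong (ab ∧_) p₀-even) (∧-zeroʳ ab))) ⟩
    middleSum xor false
      ≡⟨ xor-identityʳ middleSum ⟩
    middleSum ∎
    where
    open ≡-Reasoning
    ab = Z zero xor Z (suc zero)

  family-at : ∀ z → ⨁ family (λ X → X z) ≡
              ∑[ y < 2 + p₀ ] (weight y ∧ avoiding01 y z) xor ((Z (suc zero) ∧ avoiding023 z) xor ((Z zero ∧ avoiding123 z) xor false))
  family-at z = trans (⨁-select proj₁ proj₂ candidates (λ X → X z))
                      (trans (⨁-++ (tabulate (λ y → weight y , avoiding01 y)) extras selected-at-z)
                             (cong (_xor ⨁ extras selected-at-z) (⨁-tabulate (2 + p₀) (λ y → weight y , avoiding01 y) selected-at-z)))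
    where
    selected-at-z : Bool × (Fin (4 + p₀) → Bool) → Bool
    selected-at-z (w , X) = w ∧ X z

  family-covers : ∀ z → ⨁ family (λ X → X z) ≡ Z z
  family-covers zero = begin
    ⨁ family (λ X → X zero)
      ≡⟨ family-at zero ⟩
    ∑[ y < 2 + p₀ ] (weight y ∧ false) xor ((Z (suc zero) ∧ false) xor ((Z zero ∧ true) xor false))
      ≡⟨ cong₂ _xor_ (trans (sum-cong-≗ (λ y → ∧-zeroʳ (weight y))) (sum-replicate-zero (2 + p₀)))
                     (cong₂ _xor_ (∧-zeroʳ (Z (suc zero))) (trans (xor-identityʳ _) (∧-identityʳ (Z zero)))) ⟩
    Z zero ∎
    where open ≡-Reasoning
  family-covers (suc zero) = begin
    ⨁ family (λ X → X (suc zero))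
      ≡⟨ family-at (suc zero) ⟩
    ∑[ y < 2 + p₀ ] (weight y ∧ false) xor ((Z (suc zero) ∧ true) xor ((Z zero ∧ false) xor false))
      ≡⟨ cong₂ _xor_ (trans (sum-cong-≗ (λ y → ∧-zeroʳ (weight y))) (sum-replicate-zero (2 + p₀)))
                     (trans (cong₂ _xor_ (∧-identityʳ (Z (suc zero))) (cong (_xor false) (∧-zeroʳ (Z zero))))
                            (xor-identityʳ (Z (suc zero)))) ⟩
    Z (suc zero) ∎
    where open ≡-Reasoning
  family-covers (suc (suc w)) = begin
    ⨁ family (λ X → X (suc (suc w)))
      ≡⟨ family-at (suc (suc w)) ⟩
    ∑[ y < 2 + p₀ ] (weight y ∧ not (w == y)) xor ((Z (suc zero) ∧ outside01 w) xor ((Z zero ∧ outside01 w) xor false))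
      ≡⟨ cong₂ _xor_ others (cong ((Z (suc zero) ∧ outside01 w) xor_) (xor-identityʳ (Z zero ∧ outside01 w))) ⟩
    (middleSum xor weight w) xor ((Z (suc zero) ∧ outside01 w) xor (Z zero ∧ outside01 w))
      ≡⟨ cong ((middleSum xor weight w) xor_) (trans (sym (∧-distribʳ-xor (outside01 w) (Z (suc zero)) (Z zero)))
                                             (cong (_∧ outside01 w) (xor-comm (Z (suc zero)) (Z zero)))) ⟩
    (middleSum xor (Z (suc (suc w)) xor (middleSum xor m))) xor m
      ≡⟨ cancel middleSum (Z (suc (suc w))) m ⟩
    Z (suc (suc w)) ∎
    where
    open ≡-Reasoning
    m = (Z zero xor Z (suc zero)) ∧ outside01 w
    others : ∑[ y < 2 + p₀ ] (weight y ∧ not (w == y)) ≡ middleSum xor weight w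
    others = trans (sum-cong-≗ (λ y → trans (∧-comm (weight y) _) (cong (λ e → not e ∧ weight y) (==-sym w y))))
                   (trans (∑-except w weight) (cong (_xor weight w) ∑-weight))
    cancel : ∀ a z e → (a xor (z xor (a xor e))) xor e ≡ z
    cancel false false false = refl
    cancel false false true  = refl
    cancel false true  false = refl
    cancel false true  true  = refl
    cancel true  false false = refl
    cancel true  false true  = refl
    cancel true  true  false = refl
    cancel true  true  true  = refl

  family-sizes : All (λ X → count X ≡ suc p₀) family
  family-sizes = All-select proj₁ proj₂ {xs = candidates} (AllP.++⁺ (AllP.tabulate⁺ {f = λ y → weight y , avoiding01 y} (λ y _ → count-all-but y))
                                                  ((λ _ → cong suc (count-true p₀)) All.∷ (λ _ → cong suc (count-true p₀)) All.∷ All.[]))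

  family-length : length family ≤ 4 + p₀
  family-length = ≤-trans (length-select proj₁ proj₂ candidates)
                          (≤-reflexive (trans (List.length-++ (tabulate (λ y → weight y , avoiding01 y)))
                                              (trans (cong (_+ 2) (List.length-tabulate (λ y → weight y , avoiding01 y))) (+-comm (2 + p₀) 2))))

module _ {r m : ℕ} where

  data Side : Fin (r + m) → Set where
    inR : (a : Fin r) → Side (a ↑ˡ m)
    inO : (o : Fin m) → Side (r ↑ʳ o)

  side : (i : Fin (r + m)) → Side i
  side i with splitAt r i | Fin.join-splitAt r m i
  ... | inj₁ a | refl = inR a
  ... | inj₂ o | refl = inO o

module _ {r m : ℕ} (g : Fin m → Bool) (L : List (Fin r → Bool)) where

  covers-lift-RR : ∀ a b → covers (map (Vector._++ g) L) (a ↑ˡ m) (b ↑ˡ m) ≡ covers L a b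
  covers-lift-RR a b = trans (⨁-map (Vector._++ g) L _)
    (⨁-cong L λ Y → cong₂ _∧_ (lookup-++ˡ Y g a) (lookup-++ˡ Y g b))

  covers-lift-OR : ∀ o a → covers (map (Vector._++ g) L) (r ↑ʳ o) (a ↑ˡ m) ≡ g o ∧ ⨁ L (λ Y → Y a)
  covers-lift-OR o a = trans (⨁-map (Vector._++ g) L _)
    (trans (⨁-cong L λ Y → cong₂ _∧_ (lookup-++ʳ Y g o) (lookup-++ˡ Y g a)) (⨁-∧ L (g o) (λ Y → Y a)))

  covers-lift-OO : ∀ o o′ → (g o ∧ g o′) ≡ false → covers (map (Vector._++ g) L) (r ↑ʳ o) (r ↑ʳ o′) ≡ false
  covers-lift-OO o o′ disjoint = trans (⨁-map (Vector._++ g) L _)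
    (⨁-false L λ Y → trans (cong₂ _∧_ (lookup-++ʳ Y g o) (lookup-++ʳ Y g o′)) disjoint)

module Construction {p₀ m : ℕ} (p₀-even : ∑[ i < p₀ ] true ≡ false)
  (D : OrientedGraph (4 + p₀ + m)) (F : List (Fin (4 + p₀ + m) × Fin (4 + p₀ + m)))
  (F-unique : Unique F) (F-arcs : All (λ e → Arc (arc D) (proj₁ e) (proj₂ e)) F)
  (F-fas : AcyclicAfterDeleting (arc D) F) where

  open import Data.List.Membership.DecPropositional (_≟₂_ {4 + p₀ + m}) using (_∈?_)

  r : ℕ
  r = 4 + p₀

  A : Digraph (r + m)
  A = arc D

  ¬loop : ∀ {i j} → Arc A i j → i ≢ j
  ¬loop {i} i→i refl = case trans (sym (irrefl D i)) i→i of λ ()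

  ¬back : ∀ {i j} → Arc A i j → A j i ≡ false
  ¬back = asym D _ _

  kept : Digraph (r + m)
  kept i j = A i j ∧ not (does ((i , j) ∈? F))

  kept-acyclic : Acyclic kept
  kept-acyclic i cycle = F-fas i (TransClosure-map deleted cycle)
    where
    deleted : ∀ {i j} → Arc kept i j → DeletedArc A F i j
    deleted {i} {j} i→j with ∧-true⁻ {A i j} i→j
    ... | i→j′ , i,j∉F = i→j′ , λ i,j∈F → case trans (sym (cong not (dec-true ((i , j) ∈? F) i,j∈F))) i,j∉F of λ ()

  -- The rank and the order below are abstract: unfolding them during unification is very costly.
  abstract
    ρ : Fin (r + m) → ℕ
    ρ = proj₁ (topological-rank kept kept-acyclic)

    ρ-increasing : ∀ i j → Arc kept i j → ρ i < ρ j
    ρ-increasing = proj₁ (proj₂ (topological-rank kept kept-acyclic))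

    ρ-injective : ∀ i j → ρ i ≡ ρ j → i ≡ j
    ρ-injective = proj₂ (proj₂ (topological-rank kept kept-acyclic))

  isO : Fin (r + m) → Bool
  isO = (λ (_ : Fin r) → false) Vector.++ (λ (_ : Fin m) → true)

  padding : Fin r → Bool
  padding zero                         = false
  padding (suc zero)                   = false
  padding (suc (suc zero))             = false
  padding (suc (suc (suc zero)))       = false
  padding (suc (suc (suc (suc _))))    = true

  padding′ : Fin (r + m) → Bool
  padding′ = padding Vector.++ (λ (_ : Fin m) → false)

  padding′-O : ∀ i → isO i ≡ true → padding′ i ≡ false
  padding′-O i i∈O with side {r} {m} i
  ... | inR a = case trans (sym (lookup-++ˡ (λ (_ : Fin r) → false) (λ (_ : Fin m) → true) a)) i∈O of λ ()
  ... | inO o = lookup-++ʳ padding (λ (_ : Fin m) → false) o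

  arcSet : Fin (r + m) × Fin (r + m) → Fin (r + m) → Bool
  arcSet (u , v) i = (i == u) ∨ ((i == v) ∨ padding′ i)

  backward : Fin (r + m) × Fin (r + m) → Bool
  backward (u , v) = (isO u ∧ isO v) ∧ (ρ v <ᵇ ρ u)

  L₁ : List (Fin (r + m) → Bool)
  L₁ = select backward arcSet F

  arcSet-size : ∀ u v → Arc A u v → backward (u , v) ≡ true → count (arcSet (u , v)) ≡ 2 + p₀
  arcSet-size u v u→v selected = begin
    count (arcSet (u , v))                      ≡⟨ count-insert (λ i → (i == v) ∨ padding′ i) u
                                                     (cong₂ _∨_ (dec-false (u Fin.≟ v) (¬loop u→v)) (padding′-O u u∈O)) ⟩
    suc (count (λ i → (i == v) ∨ padding′ i))     ≡⟨ cong suc (count-insert padding′ v (padding′-O v v∈O)) ⟩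
    2 + count padding′                            ≡⟨ cong (2 +_) (count-++ padding (λ (_ : Fin m) → false)) ⟩
    2 + (count padding + count (λ (_ : Fin m) → false)) ≡⟨ cong₂ (λ x y → 2 + (x + y)) (count-true p₀) (count-false m) ⟩
    2 + (p₀ + 0)                                ≡⟨ cong (2 +_) (+-identityʳ p₀) ⟩
    2 + p₀                                      ∎
    where
    open ≡-Reasoning
    u∈O : isO u ≡ true
    u∈O = proj₁ (∧-true⁻ (proj₁ (∧-true⁻ selected)))
    v∈O : isO v ≡ true
    v∈O = proj₂ (∧-true⁻ (proj₁ (∧-true⁻ {isO u ∧ isO v} selected)))

  L₁-sizes : All (λ X → count X ≡ 2 + p₀) L₁
  L₁-sizes = All-select backward arcSet (All.map (λ {(u , v)} → arcSet-size u v) F-arcs)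

  module _ {x y : Fin (r + m)} (x∈O : isO x ≡ true) (y∈O : isO y ≡ true) (x→y : Arc A x y) where

    arcSet-both : ∀ u v → Arc A u v → (arcSet (u , v) x ∧ arcSet (u , v) y) ≡ ((x == u) ∧ (y == v))
    arcSet-both u v u→v rewrite padding′-O x x∈O | padding′-O y y∈O with x Fin.≟ u | y Fin.≟ v
    ... | yes refl | yes refl = ∨-zeroʳ (y == x)
    ... | yes refl | no _     = trans (∨-identityʳ (y == x)) (dec-false (y Fin.≟ x) (¬loop x→y ∘ sym))
    ... | no _     | yes refl = ∧-zeroˡ′ (trans (∨-identityʳ (x == y)) (dec-false (x Fin.≟ y) (¬loop x→y)))
      where
      ∧-zeroˡ′ : ∀ {a b} → a ≡ false → (a ∧ b) ≡ false
      ∧-zeroˡ′ refl = refl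
    ... | no _     | no _     with x Fin.≟ v | y Fin.≟ u
    ...   | yes refl | yes refl = case trans (sym (¬back x→y)) u→v of λ ()
    ...   | yes _    | no _     = ∧-zeroʳ true
    ...   | no _     | _        = refl

    L₁-covers : covers L₁ x y ≡ (ρ y <ᵇ ρ x)
    L₁-covers = begin
      covers L₁ x y
        ≡⟨ ⨁-select backward arcSet F (λ X → X x ∧ X y) ⟩
      ⨁ F (λ e → backward e ∧ (arcSet e x ∧ arcSet e y))
        ≡⟨ ⨁-congᴬ F-arcs (λ (u , v) u→v → trans (cong (backward (u , v) ∧_) (arcSet-both u v u→v)) (same-pair u v)) ⟩
      ⨁ F (λ e → backward (x , y) ∧ does ((x , y) ≟₂ e))
        ≡⟨ ⨁-∧ F (backward (x , y)) (λ e → does ((x , y) ≟₂ e)) ⟩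
      backward (x , y) ∧ ⨁ F (λ e → does ((x , y) ≟₂ e))
        ≡⟨ cong (backward (x , y) ∧_) (⨁-occurrences _≟₂_ F-unique (x , y)) ⟩
      backward (x , y) ∧ does ((x , y) ∈? F)
        ≡⟨ cong (λ b → (b ∧ (ρ y <ᵇ ρ x)) ∧ does ((x , y) ∈? F)) (cong₂ _∧_ x∈O y∈O) ⟩
      (ρ y <ᵇ ρ x) ∧ does ((x , y) ∈? F)
        ≡⟨ deleted-arcs-are-backward ⟩
      (ρ y <ᵇ ρ x) ∎
      where
      open ≡-Reasoning
      same-pair : ∀ u v → (backward (u , v) ∧ ((x == u) ∧ (y == v))) ≡ (backward (x , y) ∧ ((x == u) ∧ (y == v)))
      same-pair u v with x Fin.≟ u | y Fin.≟ v
      ... | yes refl | yes refl = refl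
      ... | yes _    | no _     = trans (∧-zeroʳ _) (sym (∧-zeroʳ _))
      ... | no _     | _        = trans (∧-zeroʳ _) (sym (∧-zeroʳ _))
      deleted-arcs-are-backward : ((ρ y <ᵇ ρ x) ∧ does ((x , y) ∈? F)) ≡ (ρ y <ᵇ ρ x)
      deleted-arcs-are-backward with (x , y) ∈? F
      ... | yes _   = ∧-identityʳ (ρ y <ᵇ ρ x)
      ... | no x,y∉F = trans (∧-zeroʳ (ρ y <ᵇ ρ x))
                             (sym (≮⇒<ᵇ-false (<⇒≯ (ρ-increasing x y (cong₂ _∧_ x→y (cong not (dec-false ((x , y) ∈? F) x,y∉F)))))))

  starTarget : Fin m → Fin r → Bool
  starTarget o a = A (r ↑ʳ o) (a ↑ˡ m) xor covers L₁ (r ↑ʳ o) (a ↑ˡ m)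

  star : Fin m → List (Fin (r + m) → Bool)
  star o = map (Vector._++ (_== o)) (StarGadget.family p₀-even (starTarget o))

  L₂ : List (Fin (r + m) → Bool)
  L₂ = concatMap star (allFin m)

  L₂-sizes : All (λ X → count X ≡ 2 + p₀) L₂
  L₂-sizes = All-concatMap star (allFin m) λ o → AllP.map⁺ (All.map (λ {Y} |Y| →
    trans (count-++ Y (_== o)) (trans (cong₂ _+_ |Y| (count-singleton o)) (+-comm (suc p₀) 1)))
    (StarGadget.family-sizes p₀-even (starTarget o)))

  L₂-length : length L₂ ≤ m * r
  L₂-length = subst (λ k → length L₂ ≤ k * r) (List.length-tabulate {n = m} id)
    (length-concatMap-≤ star (allFin m) λ o →
       ≤-trans (≤-reflexive (List.length-map (Vector._++ (_== o)) (StarGadget.family p₀-even (starTarget o))))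
               (StarGadget.family-length p₀-even (starTarget o)))

  L₂-covers-OR : ∀ o a → covers L₂ (r ↑ʳ o) (a ↑ˡ m) ≡ starTarget o a
  L₂-covers-OR o a = begin
    covers L₂ (r ↑ʳ o) (a ↑ˡ m)
      ≡⟨ ⨁-concatMap star (allFin m) (λ X → X (r ↑ʳ o) ∧ X (a ↑ˡ m)) ⟩
    ⨁ (allFin m) (λ o′ → covers (star o′) (r ↑ʳ o) (a ↑ˡ m))
      ≡⟨ ⨁-tabulate m id (λ o′ → covers (star o′) (r ↑ʳ o) (a ↑ˡ m)) ⟩
    ∑[ o′ < m ] covers (star o′) (r ↑ʳ o) (a ↑ˡ m)
      ≡⟨ sum-cong-≗ (λ o′ → trans (covers-lift-OR (_== o′) (StarGadget.family p₀-even (starTarget o′)) o a)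
                                  (cong₂ _∧_ (==-sym o o′) (StarGadget.family-covers p₀-even (starTarget o′) a))) ⟩
    ∑[ o′ < m ] ((o′ == o) ∧ starTarget o′ a)
      ≡⟨ ∑-select o (λ o′ → starTarget o′ a) ⟩
    starTarget o a ∎
    where open ≡-Reasoning

  L₂-covers-OO : ∀ o o′ → o ≢ o′ → covers L₂ (r ↑ʳ o) (r ↑ʳ o′) ≡ false
  L₂-covers-OO o o′ o≢o′ =
    trans (⨁-concatMap star (allFin m) (λ X → X (r ↑ʳ o) ∧ X (r ↑ʳ o′)))
          (⨁-false (allFin m) λ o″ → covers-lift-OO (_== o″) (StarGadget.family p₀-even (starTarget o″)) o o′ (one-of o″))
    where
    one-of : ∀ o″ → ((o == o″) ∧ (o′ == o″)) ≡ false
    one-of o″ with o Fin.≟ o″ | o′ Fin.≟ o″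
    ... | yes refl | yes refl = contradiction refl o≢o′
    ... | yes _    | no _     = refl
    ... | no _     | _        = refl

  r-even : ∑[ i < 2 + (2 + p₀) ] true ≡ false
  r-even = trans (∑-true-2+ (2 + p₀)) (trans (∑-true-2+ p₀) p₀-even)

  targetR : Fin r → Fin r → Bool
  targetR a b = (A (a ↑ˡ m) (b ↑ˡ m) ∧ (b ≺ a)) ∨ (A (b ↑ˡ m) (a ↑ˡ m) ∧ (a ≺ b))

  residual : Fin r → Fin r → Bool
  residual a b = targetR a b xor covers (L₁ ++ L₂) (a ↑ˡ m) (b ↑ˡ m)

  residual-sym : IsSymmetric residual
  residual-sym a b = cong₂ _xor_ (∨-comm (A (a ↑ˡ m) (b ↑ˡ m) ∧ (b ≺ a)) _) (covers-sym (L₁ ++ L₂) (a ↑ˡ m) (b ↑ˡ m))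

  module Pairs = PairGadget {2 + p₀} r-even residual residual-sym

  L₃ : List (Fin (r + m) → Bool)
  L₃ = map (Vector._++ (λ (_ : Fin m) → false)) Pairs.family

  L₃-sizes : All (λ X → count X ≡ 2 + p₀) L₃
  L₃-sizes = AllP.map⁺ (All.map (λ {Y} |Y| →
    trans (count-++ Y (λ (_ : Fin m) → false)) (trans (cong₂ _+_ |Y| (count-false m)) (+-identityʳ (2 + p₀))))
    Pairs.family-sizes)

  inversions : List (Fin (r + m) → Bool)
  inversions = (L₁ ++ L₂) ++ L₃

  inversions-sizes : All (λ X → count X ≡ 2 + p₀) inversions
  inversions-sizes = AllP.++⁺ (AllP.++⁺ L₁-sizes L₂-sizes) L₃-sizes

  inversions-length : length inversions ≤ length F + (m * r + r * r)
  inversions-length = begin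
    length ((L₁ ++ L₂) ++ L₃)              ≡⟨ List.length-++ (L₁ ++ L₂) ⟩
    length (L₁ ++ L₂) + length L₃          ≡⟨ cong (_+ length L₃) (List.length-++ L₁) ⟩
    length L₁ + length L₂ + length L₃      ≤⟨ +-mono-≤ (+-mono-≤ (length-select backward arcSet F) L₂-length)
                                                       (≤-trans (≤-reflexive (List.length-map _ Pairs.family)) Pairs.family-length) ⟩
    length F + m * r + r * r               ≡⟨ +-assoc (length F) (m * r) (r * r) ⟩
    length F + (m * r + r * r)             ∎
    where open ≤-Reasoning

  covers-inversions : ∀ i j → covers inversions i j ≡ (covers L₁ i j xor covers L₂ i j) xor covers L₃ i j
  covers-inversions i j = trans (⨁-++ (L₁ ++ L₂) L₃ (λ X → X i ∧ X j))
                                (cong (_xor covers L₃ i j) (⨁-++ L₁ L₂ (λ X → X i ∧ X j)))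

  abstract
    σ : Fin r → ℕ
    σ = relabel Pairs.parity

    σ-injective : ∀ a b → σ a ≡ σ b → a ≡ b
    σ-injective = relabel-injective Pairs.parity

    σ-order : ∀ a b → a ≢ b → (b ≺ a) xor (Pairs.parity ∧ is01 a b) ≡ (σ b <ᵇ σ a)
    σ-order = relabel-order Pairs.parity

    π : Fin (r + m) → ℕ
    π = σ Vector.++ (λ o → r + ρ (r ↑ʳ o))

    π-R : ∀ a → π (a ↑ˡ m) ≡ σ a
    π-R = lookup-++ˡ σ (λ o → r + ρ (r ↑ʳ o))

    π-O : ∀ o → π (r ↑ʳ o) ≡ r + ρ (r ↑ʳ o)
    π-O = lookup-++ʳ σ (λ o → r + ρ (r ↑ʳ o))

    R-before-O : ∀ a o → σ a < r + ρ (r ↑ʳ o)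
    R-before-O a o = ≤-trans (relabel-< Pairs.parity a) (m≤m+n r (ρ (r ↑ʳ o)))

  π-injective : ∀ i j → π i ≡ π j → i ≡ j
  π-injective i j πi≡πj with side {r} {m} i | side {r} {m} j
  ... | inR a | inR b = cong (_↑ˡ m) (σ-injective a b (trans (sym (π-R a)) (trans πi≡πj (π-R b))))
  ... | inO o | inO o′ = ρ-injective _ _ (+-cancelˡ-≡ r _ _ (trans (sym (π-O o)) (trans πi≡πj (π-O o′))))
  ... | inR a | inO o = contradiction (trans (sym (π-R a)) (trans πi≡πj (π-O o))) (<⇒≢ (R-before-O a o))
  ... | inO o | inR a = contradiction (trans (sym (π-R a)) (trans (sym πi≡πj) (π-O o))) (<⇒≢ (R-before-O a o))

  covers-OR : ∀ o a → covers inversions (r ↑ʳ o) (a ↑ˡ m) ≡ A (r ↑ʳ o) (a ↑ˡ m)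
  covers-OR o a = begin
    covers inversions (r ↑ʳ o) (a ↑ˡ m)
      ≡⟨ covers-inversions (r ↑ʳ o) (a ↑ˡ m) ⟩
    (covers L₁ (r ↑ʳ o) (a ↑ˡ m) xor covers L₂ (r ↑ʳ o) (a ↑ˡ m)) xor covers L₃ (r ↑ʳ o) (a ↑ˡ m)
      ≡⟨ cong₂ _xor_ (cong (covers L₁ (r ↑ʳ o) (a ↑ˡ m) xor_) (L₂-covers-OR o a))
                     (covers-lift-OR (λ (_ : Fin m) → false) Pairs.family o a) ⟩
    (covers L₁ (r ↑ʳ o) (a ↑ˡ m) xor starTarget o a) xor false
      ≡⟨ cancel (covers L₁ (r ↑ʳ o) (a ↑ˡ m)) (A (r ↑ʳ o) (a ↑ˡ m)) ⟩
    A (r ↑ʳ o) (a ↑ˡ m) ∎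
    where
    open ≡-Reasoning
    cancel : ∀ c t → (c xor (t xor c)) xor false ≡ t
    cancel false false = refl
    cancel false true  = refl
    cancel true  false = refl
    cancel true  true  = refl

  covers-OO : ∀ o o′ → Arc A (r ↑ʳ o) (r ↑ʳ o′) → covers inversions (r ↑ʳ o) (r ↑ʳ o′) ≡ (ρ (r ↑ʳ o′) <ᵇ ρ (r ↑ʳ o))
  covers-OO o o′ o→o′ = begin
    covers inversions (r ↑ʳ o) (r ↑ʳ o′)
      ≡⟨ covers-inversions (r ↑ʳ o) (r ↑ʳ o′) ⟩
    (covers L₁ (r ↑ʳ o) (r ↑ʳ o′) xor covers L₂ (r ↑ʳ o) (r ↑ʳ o′)) xor covers L₃ (r ↑ʳ o) (r ↑ʳ o′)
      ≡⟨ cong₂ _xor_ (cong₂ _xor_ (L₁-covers (isO-O o) (isO-O o′) o→o′) (L₂-covers-OO o o′ (¬loop o→o′ ∘ cong (r ↑ʳ_))))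
                     (covers-lift-OO (λ (_ : Fin m) → false) Pairs.family o o′ refl) ⟩
    ((ρ (r ↑ʳ o′) <ᵇ ρ (r ↑ʳ o)) xor false) xor false
      ≡⟨ trans (xor-identityʳ _) (xor-identityʳ _) ⟩
    (ρ (r ↑ʳ o′) <ᵇ ρ (r ↑ʳ o)) ∎
    where
    open ≡-Reasoning
    isO-O : ∀ o → isO (r ↑ʳ o) ≡ true
    isO-O = lookup-++ʳ (λ (_ : Fin r) → false) (λ (_ : Fin m) → true)

  covers-RR : ∀ a b → Arc A (a ↑ˡ m) (b ↑ˡ m) → covers inversions (a ↑ˡ m) (b ↑ˡ m) ≡ (σ b <ᵇ σ a)
  covers-RR a b a→b = begin
    covers inversions (a ↑ˡ m) (b ↑ˡ m)
      ≡⟨ ⨁-++ (L₁ ++ L₂) L₃ (λ X → X (a ↑ˡ m) ∧ X (b ↑ˡ m)) ⟩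
    c xor covers L₃ (a ↑ˡ m) (b ↑ˡ m)
      ≡⟨ cong (c xor_) (trans (covers-lift-RR (λ (_ : Fin m) → false) Pairs.family a b) (Pairs.family-covers a b a≢b)) ⟩
    c xor ((targetR a b xor c) xor (Pairs.parity ∧ is01 a b))
      ≡⟨ cancel c (targetR a b) _ ⟩
    targetR a b xor (Pairs.parity ∧ is01 a b)
      ≡⟨ cong (_xor (Pairs.parity ∧ is01 a b)) target ⟩
    (b ≺ a) xor (Pairs.parity ∧ is01 a b)
      ≡⟨ σ-order a b a≢b ⟩
    (σ b <ᵇ σ a) ∎
    where
    open ≡-Reasoning
    c = covers (L₁ ++ L₂) (a ↑ˡ m) (b ↑ˡ m)
    a≢b : a ≢ b
    a≢b = ¬loop a→b ∘ cong (_↑ˡ m)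
    target : targetR a b ≡ (b ≺ a)
    target rewrite a→b | ¬back a→b = ∨-identityʳ (b ≺ a)
    cancel : ∀ c t e → (c xor ((t xor c) xor e)) ≡ (t xor e)
    cancel false false e = refl
    cancel false true  e = refl
    cancel true  false e = not-involutive e
    cancel true  true  e = refl

  -- Matching on the views directly: a `with` here would normalise `covers inversions i j`.
  reversed⇔backward-by-side : ∀ {i j} → Side {r} {m} i → Side {r} {m} j → Arc A i j → covers inversions i j ≡ (π j <ᵇ π i)
  reversed⇔backward-by-side (inR a) (inR b)  a→b = trans (covers-RR a b a→b) (sym (cong₂ _<ᵇ_ (π-R b) (π-R a)))
  reversed⇔backward-by-side (inO o) (inO o′) o→o′ =
    trans (covers-OO o o′ o→o′) (sym (trans (cong₂ _<ᵇ_ (π-O o′) (π-O o)) (+-<ᵇ r _ _)))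
  reversed⇔backward-by-side (inO o) (inR a)  o→a =
    trans (covers-OR o a) (trans o→a (sym (trans (cong₂ _<ᵇ_ (π-R a) (π-O o)) (<⇒<ᵇ-true (R-before-O a o)))))
  reversed⇔backward-by-side (inR a) (inO o)  a→o =
    trans (covers-sym inversions (a ↑ˡ m) (r ↑ʳ o))
          (trans (covers-OR o a) (trans (¬back a→o) (sym (trans (cong₂ _<ᵇ_ (π-O o) (π-R a))
                                                               (≮⇒<ᵇ-false (<⇒≯ (R-before-O a o)))))))

  reversed⇔backward : ∀ i j → Arc A i j → covers inversions i j ≡ (π j <ᵇ π i)
  reversed⇔backward i j = reversed⇔backward-by-side (side {r} {m} i) (side {r} {m} j)

  inversions-acyclic : Acyclic (invertSeq (map Vec.tabulate inversions) A)
  inversions-acyclic = invertSeq-acyclic A inversions π (irrefl D) π-injective reversed⇔backward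

few-inversions-suffice : ∀ {p₀ m} → ∑[ i < p₀ ] true ≡ false →
  (D : OrientedGraph (4 + p₀ + m)) (F : List (Fin (4 + p₀ + m) × Fin (4 + p₀ + m))) → Unique F →
  All (λ e → Arc (arc D) (proj₁ e) (proj₂ e)) F → AcyclicAfterDeleting (arc D) F →
  ∃[ S ] (All (IsPInversion (2 + p₀)) S × length S ≤ length F + (m * (4 + p₀) + (4 + p₀) * (4 + p₀))
          × Acyclic (invertSeq S (arc D)))
few-inversions-suffice {p₀} {m} p₀-even D F F-unique F-arcs F-fas =
  map Vec.tabulate inversions , AllP.map⁺ inversions-sizes ,
  subst (_≤ _) (sym (List.length-map Vec.tabulate inversions)) inversions-length , inversions-acyclic
  where open Construction {p₀} {m} p₀-even D F F-unique F-arcs F-fas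

budget : ∀ f p m → 2 ≤ p → f + (m * (2 + p) + (2 + p) * (2 + p)) ≤ 2 * f + 2 * p * (2 + p + m)
budget f p m 2≤p = begin
  f + (m * (2 + p) + (2 + p) * (2 + p))   ≡⟨ cong (f +_) (sym (*-distribʳ-+ (2 + p) m (2 + p))) ⟩
  f + (m + (2 + p)) * (2 + p)             ≡⟨ cong (λ k → f + k * (2 + p)) (+-comm m (2 + p)) ⟩
  f + (2 + p + m) * (2 + p)               ≤⟨ +-mono-≤ (m≤m+n f (f + 0)) (*-monoʳ-≤ (2 + p + m) 2+p≤2p) ⟩
  2 * f + (2 + p + m) * (2 * p)           ≡⟨ cong (2 * f +_) (*-comm (2 + p + m) (2 * p)) ⟩
  2 * f + 2 * p * (2 + p + m)             ∎
  where
  open ≤-Reasoning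
  2+p≤2p : 2 + p ≤ 2 * p
  2+p≤2p = subst (2 + p ≤_) (cong (p +_) (sym (+-identityʳ p))) (+-monoˡ-≤ p 2≤p)

theorem4p9 : (p k n : ℕ) → 2 ∣ p → 2 < p → 1 ≤ k → p + 2 ≤ n →
    (D : OrientedGraph n) →
    (F : List (Fin n × Fin n)) → Unique F →
    All (λ e → Arc (arc D) (proj₁ e) (proj₂ e)) F →
    AcyclicAfterDeleting (arc D) F →
    ∃[ S ] (All (IsPInversion p) S × length S ≤ 2 * length F + 2 * p * n × Acyclic (invertSeq S (arc D)))
theorem4p9 zero          _ _ _ () _ _ _ _ _ _ _
theorem4p9 (suc zero)    _ _ _ (s≤s ()) _ _ _ _ _ _ _
theorem4p9 (suc (suc p₀)) _ n (divides q p≡2q) _ _ p+2≤n D F F-unique F-arcs F-fas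
  with m≤n⇒∃[o]m+o≡n (subst (_≤ n) (+-comm (2 + p₀) 2) p+2≤n)
... | m , refl =
  let S , S-sizes , S-length , S-acyclic = few-inversions-suffice {p₀} {m} p₀-even D F F-unique F-arcs F-fas in
  S , S-sizes , ≤-trans S-length (budget (length F) (2 + p₀) m (s≤s (s≤s z≤n))) , S-acyclic
  where
  p₀-even : ∑[ i < p₀ ] true ≡ false
  p₀-even = trans (sym (∑-true-2+ p₀)) (trans (cong (λ k → ∑[ i < k ] true) p≡2q) (∑-even q))
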